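{- Suppose that $G$ and its complement $\overline{G}$ are both nonempty graphs, with $m$ and $\overline{m}$ edges respectively. Then $$2\leq vs_{\chi'}(G)+vs_{\chi'}(\overline{G})\leq \left\lfloor \frac{m}{\chi'(G)}\right\rfloor+\left\lfloor \frac{\overline{m}}{\chi'(\overline{G})}\right\rfloor.$$
   Context: All graphs are finite and simple; nonempty means having at least one edge. $\chi'$ is the chromatic index. The chromatic vertex stability number $vs_{\chi'}(G)$ of a nonempty graph $G$ is the minimum number of vertices of $G$ whose removal results in a graph $H\subseteq G$ with $\chi'(H)\neq\chi'(G)$ (or with no edges). -}

module Defs where

open import Data.Nat using (ℕ; zero; suc; _+_; _<_; _≤_)
open import Data.Bool using (Bool; true; false; not; _∧_)
open import Data.Fin using (Fin; toℕ)
open import Data.Fin.Subset using (Subset; _∈_; _∉_; ∣_∣)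
open import Data.Product using (Σ; ∃; _×_; _,_)
open import Data.Sum using (_⊎_)
open import Data.List using (List; length; filter; allFin; concatMap; map)
open import Relation.Nullary using (¬_)
open import Relation.Binary.PropositionalEquality using (_≡_; _≢_)
open import Relation.Nullary.Decidable using (does)
open import Data.Fin.Properties using (_<?_)
open import Data.Bool.Properties using (T?)
open import Data.Bool using (T)
import Data.Vec as Vec

record Graph (n : ℕ) : Set where
  field
    adj   : Fin n → Fin n → Bool
    sym   : ∀ i j → adj i j ≡ adj j i
    irrefl : ∀ i → adj i i ≡ false
open Graph public

complement : ∀ {n} → Graph n → Graph n
complement {n} G = record
  { adj = λ i j → not (adj G i j) ∧ does (i Data.Fin.Properties.≟ j) ≡ᵇ false
  ; sym = λ i j → symC i j
  ; irrefl = λ i → irr i }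
  where
  open import Data.Bool using (if_then_else_)
  _≡ᵇ_ : Bool → Bool → Bool
  _≡ᵇ_ = λ a b → not (Data.Bool._xor_ a b)
  symC : ∀ i j → (not (adj G i j) ∧ (does (i Data.Fin.Properties.≟ j) ≡ᵇ false))
               ≡ (not (adj G j i) ∧ (does (j Data.Fin.Properties.≟ i) ≡ᵇ false))
  symC i j with adj G i j | adj G j i | sym G i j | i Data.Fin.Properties.≟ j | j Data.Fin.Properties.≟ i
  ... | a | .a | Relation.Binary.PropositionalEquality.refl | Relation.Nullary.yes p | Relation.Nullary.yes q = Relation.Binary.PropositionalEquality.refl
  ... | a | .a | Relation.Binary.PropositionalEquality.refl | Relation.Nullary.yes p | Relation.Nullary.no q = Data.Empty.⊥-elim (q (Relation.Binary.PropositionalEquality.sym p))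
    where import Data.Empty
  ... | a | .a | Relation.Binary.PropositionalEquality.refl | Relation.Nullary.no p | Relation.Nullary.yes q = Data.Empty.⊥-elim (p (Relation.Binary.PropositionalEquality.sym q))
    where import Data.Empty
  ... | a | .a | Relation.Binary.PropositionalEquality.refl | Relation.Nullary.no p | Relation.Nullary.no q = Relation.Binary.PropositionalEquality.refl
  irr : ∀ i → (not (adj G i i) ∧ (does (i Data.Fin.Properties.≟ i) ≡ᵇ false)) ≡ false
  irr i with i Data.Fin.Properties.≟ i
  ... | Relation.Nullary.yes _ with not (adj G i i)
  ...   | true = Relation.Binary.PropositionalEquality.refl
  ...   | false = Relation.Binary.PropositionalEquality.refl
  irr i | Relation.Nullary.no q = Data.Empty.⊥-elim (q Relation.Binary.PropositionalEquality.refl)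
    where import Data.Empty

edgeCount : ∀ {n} → Graph n → ℕ
edgeCount {n} G =
  length (filter (λ p → T? (adj G (Data.Product.proj₁ p) (Data.Product.proj₂ p)))
    (filter (λ p → Data.Product.proj₁ p <? Data.Product.proj₂ p)
      (concatMap (λ i → map (λ j → (i , j)) (allFin n)) (allFin n))))

Nonempty : ∀ {n} → Graph n → Set
Nonempty {n} G = Σ (Fin n) λ i → Σ (Fin n) λ j → T (adj G i j)

record EdgeColouring {n} (G : Graph n) (k : ℕ) : Set where
  field
    col     : Fin n → Fin n → Fin k
    colSym  : ∀ i j → T (adj G i j) → col i j ≡ col j i
    proper  : ∀ i j l → T (adj G i j) → T (adj G i l) → j ≢ l → col i j ≢ col i l

IsChromaticIndex : ∀ {n} → Graph n → ℕ → Set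
IsChromaticIndex G k = EdgeColouring G k × (∀ k' → k' < k → ¬ EdgeColouring G k')

-- G − S: the subgraph obtained by deleting the vertex set S (deleted vertices are
-- kept as isolated vertices, which affects neither edges nor the chromatic index).
removeVertices : ∀ {n} → Graph n → Subset n → Graph n
removeVertices {n} G S = record
  { adj = λ i j → not (Vec.lookup S i) ∧ not (Vec.lookup S j) ∧ adj G i j
  ; sym = λ i j → symR i j
  ; irrefl = λ i → irrR i }
  where
  symR : ∀ i j → (not (Vec.lookup S i) ∧ not (Vec.lookup S j) ∧ adj G i j)
               ≡ (not (Vec.lookup S j) ∧ not (Vec.lookup S i) ∧ adj G j i)
  symR i j rewrite sym G i j with Vec.lookup S i | Vec.lookup S j
  ... | true | true = Relation.Binary.PropositionalEquality.refl
  ... | true | false = Relation.Binary.PropositionalEquality.refl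
  ... | false | true = Relation.Binary.PropositionalEquality.refl
  ... | false | false = Relation.Binary.PropositionalEquality.refl
  irrR : ∀ i → (not (Vec.lookup S i) ∧ not (Vec.lookup S i) ∧ adj G i i) ≡ false
  irrR i rewrite irrefl G i with Vec.lookup S i
  ... | true = Relation.Binary.PropositionalEquality.refl
  ... | false = Relation.Binary.PropositionalEquality.refl

Destroys : ∀ {n} → Graph n → Subset n → Set
Destroys G S = ¬ Nonempty (removeVertices G S)
             ⊎ (∀ k → IsChromaticIndex G k → ¬ IsChromaticIndex (removeVertices G S) k)

IsVsChi' : ∀ {n} → Graph n → ℕ → Set
IsVsChi' {n} G s = Σ (Subset n) (λ S → ∣ S ∣ ≡ s × Destroys G S)
                 × (∀ S → Destroys G S → s ≤ ∣ S ∣)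

module Submission where

-- Deleting no vertex leaves a graph with the same edges, hence the same
-- chromatic index, so a vertex set destroying χ' is nonempty: vs_χ'(G) ≥ 1, and the same
-- holds for the complement.
--
-- Fix a proper colouring of G with χ'(G) = k + 1 colours.  Its colour classes
-- partition the m edges, so by averaging some class c has at most m/(k+1) edges.  Deleting
-- the smaller endpoint of every edge of colour c leaves a graph none of whose edges has
-- colour c; dropping that colour recolours it properly with k colours, so the deletion
-- changes χ' (or removes all edges).  Hence vs_χ'(G) ≤ ⌊m/χ'(G)⌋, and likewise for the
-- complement.

open import Defs
open import Data.Nat using (ℕ; suc; _+_; _≤_; _/_)
open import Data.Product using (_×_)

open import Data.Bool using (true; false; T; if_then_else_)
open import Data.Bool.Properties using (T?; not-¬)
open import Data.Empty using (⊥-elim)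
open import Data.Fin using (Fin; zero; suc; punchOut) renaming (_<_ to _<ᶠ_)
open import Data.Fin.Properties using (_≟_; _<?_; any?; punchOut-injective)
  renaming (<-cmp to <ᶠ-cmp)
open import Data.Fin.Subset using (Subset; ⊥; ⁅_⁆; _∪_; ∣_∣; inside; outside)
  renaming (_∈_ to _∈ˢ_)
open import Data.Fin.Subset.Properties using (x∈⁅x⁆; x∈p∪q⁺; ∣⁅x⁆∣≡1; ∣⊥∣≡0)
open import Data.List using (List; []; _∷_; length; filter; concatMap; map; allFin)
open import Data.List.Membership.Propositional using (_∈_)
open import Data.List.Membership.Propositional.Properties
  using (∈-filter⁺; ∈-concatMap⁺; ∈-map⁺; ∈-allFin)
import Data.List.Relation.Unary.Any as Any
open import Data.Nat using (zero; _*_; _<_; z≤n; s≤s; _≤?_)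
open import Data.Nat.DivMod using (m*n/n≡m; /-monoˡ-≤)
open import Data.Nat.Properties
  using ( +-0-commutativeMonoid; +-suc; *-comm; *-monoʳ-≤; +-mono-≤; +-monoʳ-≤
        ; ≤-refl; ≤-trans; ≤-reflexive; n≤1+n; <⇒≤; ≰⇒>; <-cmp; module ≤-Reasoning)
open import Data.Product using (∃-syntax; _,_; proj₁; proj₂)
open import Data.Sum using (inj₁; inj₂)
open import Data.Vec using ([]; _∷_; lookup)
open import Data.Vec.Properties using ([]=⇒lookup)
open import Relation.Binary using (tri<; tri≈; tri>)
open import Relation.Binary.PropositionalEquality
  using (_≡_; _≢_; refl; trans; cong; cong₂; subst; module ≡-Reasoning)
  renaming (sym to ≡-sym)
open import Relation.Nullary using (Dec; yes; no; does)

open import Algebra.Properties.CommutativeMonoid.Sum +-0-commutativeMonoid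
  using (sum; sum-cong-≗; ∑-distrib-+; sum-replicate-zero)

variable
  n k : ℕ

averaging : ∀ k (f : Fin (suc k) → ℕ) → ∃[ c ] suc k * f c ≤ sum f
averaging zero    f = zero , ≤-refl
averaging (suc k) f with averaging k (λ c → f (suc c))
... | c , avg with f zero ≤? f (suc c)
...   | yes f₀≤ = zero , +-monoʳ-≤ (f zero) (≤-trans (*-monoʳ-≤ (suc k) f₀≤) avg)
...   | no  f₀≰ = suc c , +-mono-≤ (<⇒≤ (≰⇒> f₀≰)) avg

*≤⇒≤/ : ∀ d a m → suc d * a ≤ m → a ≤ m / suc d
*≤⇒≤/ d a m da≤m =
  subst (_≤ m / suc d) (m*n/n≡m a (suc d))
        (/-monoˡ-≤ (suc d) (subst (_≤ m) (*-comm (suc d) a) da≤m))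

-- The indicator [x = c] of a fixed element x of Fin m; it sums to 1 over c, which is
-- what makes class sizes add up.
δ : ∀ {m} → Fin m → Fin m → ℕ
δ x c = if does (x ≟ c) then 1 else 0

sum-δ : ∀ {m} (x : Fin m) → sum (δ x) ≡ 1
sum-δ {suc m} zero    = cong suc (sum-replicate-zero m)
sum-δ {suc m} (suc x) = trans (sum-cong-≗ δ-suc) (sum-δ x)
  where
  δ-suc : ∀ c → δ (suc x) (suc c) ≡ δ x c
  δ-suc c with x ≟ c
  ... | yes _ = refl
  ... | no  _ = refl

class : ∀ {a} {A : Set a} {m} → (A → Fin m) → Fin m → List A → List A
class κ c = filter (λ x → κ x ≟ c)

length-class-∷ : ∀ {a} {A : Set a} {m} (κ : A → Fin m) x xs c →
                 length (class κ c (x ∷ xs)) ≡ δ (κ x) c + length (class κ c xs)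
length-class-∷ κ x xs c with κ x ≟ c
... | yes _ = refl
... | no  _ = refl

sum-class : ∀ {a} {A : Set a} {m} (κ : A → Fin m) xs →
            sum (λ c → length (class κ c xs)) ≡ length xs
sum-class {m = m} κ []       = sum-replicate-zero m
sum-class         κ (x ∷ xs) = begin
  sum (λ c → length (class κ c (x ∷ xs)))              ≡⟨ sum-cong-≗ (length-class-∷ κ x xs) ⟩
  sum (λ c → δ (κ x) c + length (class κ c xs))       ≡⟨ ∑-distrib-+ (δ (κ x)) _ ⟩
  sum (δ (κ x)) + sum (λ c → length (class κ c xs))   ≡⟨ cong₂ _+_ (sum-δ (κ x)) (sum-class κ xs) ⟩
  suc (length xs)                                     ∎
  where open ≡-Reasoning

∣p∪q∣≤∣p∣+∣q∣ : (p q : Subset n) → ∣ p ∪ q ∣ ≤ ∣ p ∣ + ∣ q ∣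
∣p∪q∣≤∣p∣+∣q∣ []            []            = z≤n
∣p∪q∣≤∣p∣+∣q∣ (outside ∷ p) (outside ∷ q) = ∣p∪q∣≤∣p∣+∣q∣ p q
∣p∪q∣≤∣p∣+∣q∣ (outside ∷ p) (inside  ∷ q) =
  ≤-trans (s≤s (∣p∪q∣≤∣p∣+∣q∣ p q)) (≤-reflexive (≡-sym (+-suc ∣ p ∣ ∣ q ∣)))
∣p∪q∣≤∣p∣+∣q∣ (inside  ∷ p) (outside ∷ q) = s≤s (∣p∪q∣≤∣p∣+∣q∣ p q)
∣p∪q∣≤∣p∣+∣q∣ (inside  ∷ p) (inside  ∷ q) =
  s≤s (≤-trans (∣p∪q∣≤∣p∣+∣q∣ p q) (+-monoʳ-≤ ∣ p ∣ (n≤1+n ∣ q ∣)))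

firsts : ∀ {b} {B : Set b} → List (Fin n × B) → Subset n
firsts []       = ⊥
firsts (e ∷ es) = ⁅ proj₁ e ⁆ ∪ firsts es

∣firsts∣≤length : ∀ {b} {B : Set b} (es : List (Fin n × B)) → ∣ firsts es ∣ ≤ length es
∣firsts∣≤length {n} []       = ≤-reflexive (∣⊥∣≡0 n)
∣firsts∣≤length     (e ∷ es) =
  ≤-trans (∣p∪q∣≤∣p∣+∣q∣ ⁅ proj₁ e ⁆ (firsts es))
          (+-mono-≤ (≤-reflexive (∣⁅x⁆∣≡1 (proj₁ e))) (∣firsts∣≤length es))

∈-firsts : ∀ {b} {B : Set b} {i : Fin n} {j : B} {es} → (i , j) ∈ es → i ∈ˢ firsts es
∈-firsts (Any.here refl) = x∈p∪q⁺ (inj₁ (x∈⁅x⁆ _))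
∈-firsts (Any.there e∈)  = x∈p∪q⁺ (inj₂ (∈-firsts e∈))

-- The edges of G, listed as in edgeCount: pairs (i , j) with i < j.
edges : Graph n → List (Fin n × Fin n)
edges {n} G =
  filter (λ p → T? (adj G (proj₁ p) (proj₂ p)))
    (filter (λ p → proj₁ p <? proj₂ p)
      (concatMap (λ i → map (λ j → (i , j)) (allFin n)) (allFin n)))

∈-edges : ∀ (G : Graph n) {i j} → i <ᶠ j → T (adj G i j) → (i , j) ∈ edges G
∈-edges {n} G {i} {j} i<j ij =
  ∈-filter⁺ _ (∈-filter⁺ _ (∈-concatMap⁺ _ (Any.map pair∈ (∈-allFin i))) i<j) ij
  where
  pair∈ : ∀ {i′} → i ≡ i′ → (i , j) ∈ map (λ j′ → (i′ , j′)) (allFin n)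
  pair∈ refl = ∈-map⁺ _ (∈-allFin j)

nonempty? : (G : Graph n) → Dec (Nonempty G)
nonempty? G = any? (λ i → any? (λ j → T? (adj G i j)))

_⊆ᴳ_ : Graph n → Graph n → Set
H ⊆ᴳ G = ∀ {i j} → T (adj H i j) → T (adj G i j)

removed-edge : ∀ (G : Graph n) S {i j} → T (adj (removeVertices G S) i j) →
               lookup S i ≡ false × lookup S j ≡ false × T (adj G i j)
removed-edge G S {i} {j} ij with lookup S i | lookup S j | adj G i j
... | false | false | true = refl , refl , ij

removeVertices-⊆ : ∀ (G : Graph n) S → removeVertices G S ⊆ᴳ G
removeVertices-⊆ G S ij = proj₂ (proj₂ (removed-edge G S ij))

∣S∣≡0⇒∉ : ∀ (S : Subset n) → ∣ S ∣ ≡ 0 → ∀ i → lookup S i ≡ false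
∣S∣≡0⇒∉ (outside ∷ S) ∣S∣≡0 zero    = refl
∣S∣≡0⇒∉ (outside ∷ S) ∣S∣≡0 (suc i) = ∣S∣≡0⇒∉ S ∣S∣≡0 i
∣S∣≡0⇒∉ (inside  ∷ S) ()    i

G⊆G−∅ : ∀ (G : Graph n) S → ∣ S ∣ ≡ 0 → G ⊆ᴳ removeVertices G S
G⊆G−∅ G S ∣S∣≡0 {i} {j} ij rewrite ∣S∣≡0⇒∉ S ∣S∣≡0 i | ∣S∣≡0⇒∉ S ∣S∣≡0 j = ij

restrict : ∀ {G H : Graph n} → H ⊆ᴳ G → EdgeColouring G k → EdgeColouring H k
restrict H⊆G C = record
  { col    = col
  ; colSym = λ i j ij → colSym i j (H⊆G ij)
  ; proper = λ i j l ij il → proper i j l (H⊆G ij) (H⊆G il) }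
  where open EdgeColouring C

chromaticIndex-transfer : ∀ {G H : Graph n} → G ⊆ᴳ H → H ⊆ᴳ G →
                          IsChromaticIndex G k → IsChromaticIndex H k
chromaticIndex-transfer G⊆H H⊆G (C , minimal) =
  restrict H⊆G C , λ k′ k′<k C′ → minimal k′ k′<k (restrict G⊆H C′)

chromaticIndex-unique : ∀ {G : Graph n} {a b} →
                        IsChromaticIndex G a → IsChromaticIndex G b → a ≡ b
chromaticIndex-unique {a = a} {b} (Cₐ , minₐ) (C_b , min_b) with <-cmp a b
... | tri< a<b _ _ = ⊥-elim (min_b a a<b Cₐ)
... | tri≈ _ a≡b _ = a≡b
... | tri> _ _ b<a = ⊥-elim (minₐ b b<a C_b)

-- Collapsing the colour c: a k-colour name for every colour other than c (the default d
-- is used for c itself), injective away from c.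
collapse : ∀ (c : Fin (suc k)) → Fin k → Fin (suc k) → Fin k
collapse c d x with c ≟ x
... | yes _   = d
... | no  c≢x = punchOut c≢x

collapse-injective : ∀ (c : Fin (suc k)) d {x y} → x ≢ c → y ≢ c →
                     collapse c d x ≡ collapse c d y → x ≡ y
collapse-injective c d {x} {y} x≢c y≢c eq with c ≟ x | c ≟ y
... | yes c≡x | _       = ⊥-elim (x≢c (≡-sym c≡x))
... | no  _   | yes c≡y = ⊥-elim (y≢c (≡-sym c≡y))
... | no  c≢x | no  c≢y = punchOut-injective c≢x c≢y eq

drop-colour : ∀ {G : Graph n} {k} (C : EdgeColouring G (suc k)) (c : Fin (suc k)) →
              (∀ {i j} → T (adj G i j) → EdgeColouring.col C i j ≢ c) →
              Nonempty G → EdgeColouring G k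
drop-colour {k = k} C c avoids (i₀ , j₀ , i₀j₀) = record
  { col    = λ i j → collapse c d (col i j)
  ; colSym = λ i j ij → cong (collapse c d) (colSym i j ij)
  ; proper = λ i j l ij il j≢l eq →
      proper i j l ij il j≢l (collapse-injective c d (avoids ij) (avoids il) eq) }
  where
  open EdgeColouring C
  d : Fin k
  d = punchOut (λ c≡col → avoids i₀j₀ (≡-sym c≡col))

destroys-by-fewer-colours : ∀ {G : Graph n} {k S} → IsChromaticIndex G (suc k) →
  (Nonempty (removeVertices G S) → EdgeColouring (removeVertices G S) k) → Destroys G S
destroys-by-fewer-colours {G = G} {k} {S} χG fewer with nonempty? (removeVertices G S)
... | no  edgeless = inj₁ edgeless
... | yes nonempty = inj₂ λ k′ χ′G χ′G−S →
  proj₂ χ′G−S k (subst (k <_) (chromaticIndex-unique χG χ′G) ≤-refl) (fewer nonempty)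

-- Lower bound: deleting no vertex keeps every edge of G and hence χ'(G), so a vertex set
-- destroying χ' of a nonempty graph is nonempty.
vs≥1 : ∀ {G : Graph n} {k s} → Nonempty G → IsChromaticIndex G k → IsVsChi' G s → 1 ≤ s
vs≥1             {s = suc s} _ _ _ = s≤s z≤n
vs≥1 {G = G} {k} {zero} (i , j , ij) χG ((S , ∣S∣≡0 , destroys) , _) with destroys
... | inj₁ edgeless = ⊥-elim (edgeless (i , j , G⊆G−∅ G S ∣S∣≡0 ij))
... | inj₂ changed  = ⊥-elim (changed k χG
  (chromaticIndex-transfer (G⊆G−∅ G S ∣S∣≡0) (removeVertices-⊆ G S) χG))

-- Upper bound: deleting one endpoint of each edge of a smallest colour class of a proper
-- χ'(G)-colouring destroys χ'(G).
module UpperBound {n k} (G : Graph n) (χG : IsChromaticIndex G (suc k)) where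
  open EdgeColouring (proj₁ χG)

  colourOf : Fin n × Fin n → Fin (suc k)
  colourOf (i , j) = col i j

  colourClass : Fin (suc k) → List (Fin n × Fin n)
  colourClass c = class colourOf c (edges G)

  hitting : Fin (suc k) → Subset n
  hitting c = firsts (colourClass c)

  hitting-covers : ∀ {c a b} → a <ᶠ b → T (adj G a b) → col a b ≡ c →
                   lookup (hitting c) a ≡ true
  hitting-covers a<b ab col≡c = []=⇒lookup (∈-firsts (∈-filter⁺ _ (∈-edges G a<b ab) col≡c))

  avoids : ∀ c {i j} → T (adj (removeVertices G (hitting c)) i j) → col i j ≢ c
  avoids c {i} {j} ij col≡c with removed-edge G (hitting c) ij
  ... | i∉ , j∉ , ijᴳ with <ᶠ-cmp i j
  ...   | tri< i<j _ _  = not-¬ i∉ (hitting-covers i<j ijᴳ col≡c)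
  ...   | tri≈ _ refl _ = subst T (irrefl G i) ijᴳ
  ...   | tri> _ _ j<i  = not-¬ j∉ (hitting-covers j<i (subst T (Graph.sym G i j) ijᴳ)
                                     (trans (≡-sym (colSym i j ijᴳ)) col≡c))

  destroys : ∀ c → Destroys G (hitting c)
  destroys c = destroys-by-fewer-colours χG
    (drop-colour (restrict (removeVertices-⊆ G (hitting c)) (proj₁ χG)) c (avoids c))

  small-class : ∃[ c ] length (colourClass c) ≤ edgeCount G / suc k
  small-class with averaging k (λ c → length (colourClass c))
  ... | c , below-mean = c , *≤⇒≤/ k _ _ below-total
    where
    below-total : suc k * length (colourClass c) ≤ edgeCount G
    below-total = subst (suc k * length (colourClass c) ≤_)
                        (sum-class colourOf (edges G)) below-mean

  vs≤m/χ' : ∀ {s} → IsVsChi' G s → s ≤ edgeCount G / suc k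
  vs≤m/χ' {s} (_ , minimal) with small-class
  ... | c , small = begin
    s                        ≤⟨ minimal (hitting c) (destroys c) ⟩
    ∣ hitting c ∣            ≤⟨ ∣firsts∣≤length (colourClass c) ⟩
    length (colourClass c)   ≤⟨ small ⟩
    edgeCount G / suc k      ∎
    where open ≤-Reasoning

mainTheorem10 : ∀ (n : ℕ) (G : Graph n) → Nonempty G → Nonempty (complement G)
    → ∀ (k kc s sc : ℕ)
    → IsChromaticIndex G (suc k)
    → IsChromaticIndex (complement G) (suc kc)
    → IsVsChi' G s → IsVsChi' (complement G) sc
    → (2 ≤ s + sc) × (s + sc ≤ edgeCount G / suc k + edgeCount (complement G) / suc kc)
mainTheorem10 n G edge edgeᶜ k kc s sc χG χGᶜ vsG vsGᶜ =
  +-mono-≤ (vs≥1 edge χG vsG) (vs≥1 edgeᶜ χGᶜ vsGᶜ) ,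
  +-mono-≤ (UpperBound.vs≤m/χ' G χG vsG) (UpperBound.vs≤m/χ' (complement G) χGᶜ vsGᶜ)
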